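{- Let $K \geq 2$ and $p \geq 1$ be integers. Let $\sigma$ be a permutation with $\sigma \notin \mathcal{C}(K,p)$ such that every strict pattern $\tau$ of $\sigma$ (pattern with $|\tau| < |\sigma|$) belongs to $\mathcal{C}(K,p)$. Then the vp-domain of $\sigma$ has size at most $2Kp+2$.
   Context: A permutation $\pi \in S_k$ is a pattern of $\sigma \in S_n$ if $\sigma$ has a subsequence order-isomorphic to $\pi$. A duplication-loss step of width $k$ applied to a permutation $\pi$ chooses a contiguous fragment of $k$ consecutive positions and a subset $S$ of its entries, and replaces the fragment by the entries of $S$ in their original relative order followed by the remaining entries of the fragment in their original relative order. $\mathcal{C}(K,p)$ is the class of all permutations (of any size $n$) obtained from the identity $12\ldots n$ after $p$ duplication-loss steps each of width at most $K$. For $\sigma \in S_n$, the vector from value $a$ to value $b$ consists of all entries whose positions lie between the positions of the entries of values $a$ and $b$, inclusive. The vp-vector associated with $i$ is the vector from $i$ to $\sigma_i$ if $\sigma_i \neq i$, and empty if $\sigma_i = i$. The vp-domain of $\sigma$ is the set of entries of $\sigma$ appearing in at least one vp-vector. -}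

module Defs where

open import Data.Nat using (ℕ; zero; suc; _+_; _*_; _≤_; _<_; _⊔_; _⊓_)
open import Data.Bool using (Bool; true; false)
open import Data.Fin using (Fin; toℕ; cast)
open import Data.List using (List; []; _∷_; _++_; length; upTo; lookup)
open import Data.List.Relation.Binary.Permutation.Propositional using (_↭_)
open import Data.List.Relation.Binary.Sublist.Propositional using (_⊆_)
open import Data.Product using (Σ; ∃; ∃-syntax; _×_; _,_)
open import Function.Bundles using (_⇔_)
open import Relation.Binary.PropositionalEquality using (_≡_; _≢_)

-- Convention: a permutation of size n is a list of the values 0,1,…,n-1
-- (0-based values and 0-based positions; the identity is upTo n).
IsPerm : List ℕ → Set
IsPerm σ = σ ↭ upTo (length σ)

-- entries of a fragment selected by a Boolean mask (true = in S), in order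
select : {A : Set} → List Bool → List A → List A
select (true  ∷ m) (x ∷ xs) = x ∷ select m xs
select (false ∷ m) (x ∷ xs) = select m xs
select _ _ = []

reject : {A : Set} → List Bool → List A → List A
reject (true  ∷ m) (x ∷ xs) = reject m xs
reject (false ∷ m) (x ∷ xs) = x ∷ reject m xs
reject _ _ = []

DLStep : ℕ → List ℕ → List ℕ → Set
DLStep K π π' =
  Σ (List ℕ) λ a → Σ (List ℕ) λ f → Σ (List ℕ) λ b → Σ (List Bool) λ m →
    (length f ≤ K) × (length m ≡ length f) ×
    (π ≡ a ++ f ++ b) × (π' ≡ a ++ select m f ++ reject m f ++ b)

data Steps (K : ℕ) : ℕ → List ℕ → List ℕ → Set where
  done : ∀ {π} → Steps K zero π π
  step : ∀ {p π π' π''} → DLStep K π π' → Steps K p π' π'' → Steps K (suc p) π π''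

InC : ℕ → ℕ → List ℕ → Set
InC K p σ = Steps K p (upTo (length σ)) σ

OrderIso : List ℕ → List ℕ → Set
OrderIso xs ys = Σ (length xs ≡ length ys) λ eq →
  ∀ i j → (lookup xs i < lookup xs j) ⇔ (lookup ys (cast eq i) < lookup ys (cast eq j))

IsPattern : List ℕ → List ℕ → Set
IsPattern τ σ = IsPerm τ × ∃[ s ] (s ⊆ σ × OrderIso s τ)

-- v lies in the vp-vector associated with (position/value) i of σ:
-- σ_i ≠ i, j is the position of value i, and v is the entry at a position q
-- between j and i inclusive
InVPVector : (σ : List ℕ) → Fin (length σ) → ℕ → Set
InVPVector σ i v =
  (lookup σ i ≢ toℕ i) ×
  Σ (Fin (length σ)) λ j → Σ (Fin (length σ)) λ q →
    (lookup σ j ≡ toℕ i) × (lookup σ q ≡ v) ×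
    ((toℕ j ⊓ toℕ i) ≤ toℕ q) × (toℕ q ≤ (toℕ j ⊔ toℕ i))

InVPDomain : List ℕ → ℕ → Set
InVPDomain σ v = ∃[ i ] InVPVector σ i v

-- Call a cut c ∈ {0,…,n} of σ splitting when the first c entries of σ are exactly the values below c.
-- The identity splits everywhere, and a duplication-loss step of width at most K only permutes a window
-- of at most K entries, so it can destroy only the cuts strictly inside that window: a member of C(K,p)
-- has at most p(K−1) non-splitting cuts. An entry of value i at position j ≠ i blocks every cut c with
-- min(i,j) < c ≤ max(i,j), so each entry of a vp-vector is adjacent to a non-splitting cut, and the
-- vp-domain has at most twice as many elements as σ has non-splitting cuts. Finally, let b be the first
-- position where σ differs from the identity; deleting the entry σ_b (if σ_b is at most the position of
-- the value b) or else the value b gives a strict pattern τ with at most one non-splitting cut fewer.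
-- By minimality τ ∈ C(K,p), so the vp-domain has at most 2(p(K−1)+1) ≤ 2Kp+2 elements.

module Submission where

open import Defs
open import Level using (0ℓ)
open import Data.Nat
open import Data.Nat.Properties
open import Data.Bool using (Bool; true; false)
open import Data.Fin using (Fin; zero; suc; toℕ; cast)
open import Data.Fin.Properties using (toℕ-injective; toℕ<n)
open import Data.Product using (Σ; ∃; _×_; _,_; proj₁; uncurry)
open import Data.Sum as Sum using (_⊎_; inj₁; inj₂)
open import Data.Empty using (⊥-elim)
open import Data.List using (List; []; _∷_; length; _++_; take; drop; map; lookup; upTo; applyUpTo)
open import Data.List.Properties using (length-++; ++-assoc; ++-identityʳ; length-map; map-++; take-map; drop-map)
open import Data.List.Relation.Unary.All as All using (All; []; _∷_)
open import Data.List.Relation.Unary.Any using (here; there)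
import Data.List.Relation.Unary.All.Properties as All
open import Data.List.Relation.Unary.Unique.Propositional using (Unique; []; _∷_)
import Data.List.Relation.Unary.Unique.Propositional.Properties as Unique
open import Data.List.Membership.Propositional using (_∈_)
open import Data.List.Membership.Propositional.Properties using (∈-∃++; ∈-++⁻; ∈-++⁺ˡ; ∈-insert; ∈-lookup; ∈-upTo⁻; ∈-upTo⁺)
open import Data.List.Membership.DecPropositional _≟_ using (_∈?_)
open import Data.List.Relation.Binary.Permutation.Propositional using (_↭_; ↭-refl; ↭-sym; ↭-trans; ↭-prep; ↭⇒↭ₛ)
open import Data.List.Relation.Binary.Permutation.Propositional.Properties
  using (shift; ↭-length; All-resp-↭; ∈-resp-↭; ++⁺ˡ; ++⁺ʳ; drop-mid; map⁺)
import Data.List.Relation.Binary.Permutation.Setoid.Properties as PermutationSetoid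
open import Data.List.Relation.Binary.Sublist.Propositional using (⊆-refl; _∷ʳ_)
import Data.List.Relation.Binary.Sublist.Propositional.Properties as Sublist
open import Function.Bundles using (mk⇔)
open import Relation.Unary using (Pred; Decidable)
open import Relation.Unary.Properties using (_∪?_; _∩?_; ∁?)
open import Relation.Nullary using (¬_; yes; no)
open import Relation.Nullary.Decidable using (_×-dec_)
open import Relation.Binary.PropositionalEquality
open import Relation.Binary.Definitions using (tri<; tri≈; tri>)
open import Function using (_∘_)

module _ {A : Set} where

  length-++-∷ : ∀ (xs : List A) {y} ys → length (xs ++ y ∷ ys) ≡ suc (length (xs ++ ys))
  length-++-∷ [] ys = refl
  length-++-∷ (x ∷ xs) ys = cong suc (length-++-∷ xs ys)

  take-++-≤ : ∀ {c} (xs ys : List A) → c ≤ length xs → take c (xs ++ ys) ≡ take c xs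
  take-++-≤ {zero} xs ys _ = refl
  take-++-≤ {suc c} (x ∷ xs) ys (s≤s c≤) = cong (x ∷_) (take-++-≤ xs ys c≤)

  drop-++-≤ : ∀ {c} (xs ys : List A) → c ≤ length xs → drop c (xs ++ ys) ≡ drop c xs ++ ys
  drop-++-≤ {zero} xs ys _ = refl
  drop-++-≤ {suc c} (x ∷ xs) ys (s≤s c≤) = drop-++-≤ xs ys c≤

  take-++-≥ : ∀ {c} (xs ys : List A) → length xs ≤ c → take c (xs ++ ys) ≡ xs ++ take (c ∸ length xs) ys
  take-++-≥ [] ys _ = refl
  take-++-≥ {suc c} (x ∷ xs) ys (s≤s ≤c) = cong (x ∷_) (take-++-≥ xs ys ≤c)

  drop-++-≥ : ∀ {c} (xs ys : List A) → length xs ≤ c → drop c (xs ++ ys) ≡ drop (c ∸ length xs) ys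
  drop-++-≥ [] ys _ = refl
  drop-++-≥ {suc c} (x ∷ xs) ys (s≤s ≤c) = drop-++-≥ xs ys ≤c

  module _ {P : Pred A 0ℓ} where

    All-++-∷ : ∀ xs {x ys} → All P (xs ++ ys) → P x → All P (xs ++ x ∷ ys)
    All-++-∷ xs pxys px = let pxs , pys = All.++⁻ xs pxys in All.++⁺ pxs (px ∷ pys)

    All-take-∷ : ∀ xs {x ys c} → length xs < c → All P (take c (xs ++ x ∷ ys)) → P x
    All-take-∷ [] {c = suc c} _ (px ∷ _) = px
    All-take-∷ (_ ∷ xs) {c = suc c} (s≤s xs<c) (_ ∷ pxs) = All-take-∷ xs xs<c pxs

    All-drop-∷ : ∀ xs {x ys c} → c ≤ length xs → All P (drop c (xs ++ x ∷ ys)) → P x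
    All-drop-∷ xs {c = zero} _ pxs = All.lookup pxs (∈-insert xs)
    All-drop-∷ (_ ∷ xs) {c = suc c} (s≤s c≤xs) pxs = All-drop-∷ xs c≤xs pxs

Unique-resp-↭ : {xs ys : List ℕ} → xs ↭ ys → Unique xs → Unique ys
Unique-resp-↭ p = PermutationSetoid.Unique-resp-↭ (setoid ℕ) (↭⇒↭ₛ p)

Unique-remove : ∀ xs (v : ℕ) ys → Unique (xs ++ v ∷ ys) → All (v ≢_) (xs ++ ys) × Unique (xs ++ ys)
Unique-remove xs v ys u with Unique-resp-↭ (shift v xs ys) u
... | v∉ ∷ u′ = v∉ , u′

-- Counting

count : {P : Pred ℕ 0ℓ} → Decidable P → ℕ → ℕ
count P? zero = 0
count P? (suc N) with P? N
... | yes _ = suc (count P? N)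
... | no _ = count P? N

module _ {P : Pred ℕ 0ℓ} (P? : Decidable P) where

  count-yes : ∀ {N} → P N → count P? (suc N) ≡ suc (count P? N)
  count-yes {N} pN with P? N
  ... | yes _ = refl
  ... | no ¬pN = ⊥-elim (¬pN pN)

  count-suc≤ : ∀ N → count P? N ≤ count P? (suc N)
  count-suc≤ N with P? N
  ... | yes _ = n≤1+n _
  ... | no _ = ≤-refl

  count-suc≤suc : ∀ N → count P? (suc N) ≤ suc (count P? N)
  count-suc≤suc N with P? N
  ... | yes _ = ≤-refl
  ... | no _ = n≤1+n _

  count-shift≤ : ∀ N → count (λ c → P? (suc c)) N ≤ count P? (suc N)
  count-shift≤ zero = z≤n
  count-shift≤ (suc N) with P? (suc N)
  ... | yes _ = s≤s (count-shift≤ N)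
  ... | no _ = count-shift≤ N

  count-≡0 : ∀ N → (∀ {c} → c < N → ¬ P c) → count P? N ≡ 0
  count-≡0 zero _ = refl
  count-≡0 (suc N) ¬P with P? N
  ... | yes p = ⊥-elim (¬P ≤-refl p)
  ... | no _ = count-≡0 N (¬P ∘ m<n⇒m<1+n)

  private
    narrow : ∀ {N xs} → All (λ x → x < suc N × P x) xs → All (N ≢_) xs → All (λ x → x < N × P x) xs
    narrow below N∉xs = All.zipWith (λ ((x<1+N , px) , N≢x) → ≤∧≢⇒< (≤-pred x<1+N) (N≢x ∘ sym) , px) (below , N∉xs)

  pigeonhole : ∀ N xs → Unique xs → All (λ x → x < N × P x) xs → length xs ≤ count P? N
  pigeonhole zero [] _ _ = z≤n
  pigeonhole zero (_ ∷ _) _ ((() , _) ∷ _)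
  pigeonhole (suc N) xs u below with N ∈? xs
  ... | no N∉xs = ≤-trans (pigeonhole N xs u (narrow below (All.¬Any⇒All¬ xs N∉xs))) (count-suc≤ N)
  ... | yes N∈xs with ∈-∃++ N∈xs
  ...   | A , B , refl with All.++⁻ A below | Unique-remove A N B u
  ...     | belowA , (_ , pN) ∷ belowB | N∉AB , uAB = begin
      length (A ++ N ∷ B)   ≡⟨ length-++-∷ A B ⟩
      suc (length (A ++ B)) ≤⟨ s≤s (pigeonhole N (A ++ B) uAB (narrow (All.++⁺ belowA belowB) N∉AB)) ⟩
      suc (count P? N)      ≡⟨ count-yes pN ⟨
      count P? (suc N)      ∎
    where open ≤-Reasoning

module _ {P Q : Pred ℕ 0ℓ} (P? : Decidable P) (Q? : Decidable Q) where

  count-mono : ∀ N → (∀ {c} → c < N → P c → Q c) → count P? N ≤ count Q? N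
  count-mono zero _ = z≤n
  count-mono (suc N) P⇒Q with P? N | Q? N
  ... | yes pN | yes _ = s≤s (count-mono N (P⇒Q ∘ m<n⇒m<1+n))
  ... | yes pN | no ¬qN = ⊥-elim (¬qN (P⇒Q ≤-refl pN))
  ... | no _ | yes _ = m≤n⇒m≤1+n (count-mono N (P⇒Q ∘ m<n⇒m<1+n))
  ... | no _ | no _ = count-mono N (P⇒Q ∘ m<n⇒m<1+n)

  count-∪ : ∀ N → count (P? ∪? Q?) N ≤ count P? N + count Q? N
  count-∪ zero = z≤n
  count-∪ (suc N) with P? N | Q? N
  ... | yes _ | yes _ = s≤s (≤-trans (count-∪ N) (+-monoʳ-≤ (count P? N) (n≤1+n _)))
  ... | yes _ | no _ = s≤s (count-∪ N)
  ... | no _ | yes _ = ≤-trans (s≤s (count-∪ N)) (≤-reflexive (sym (+-suc _ _)))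
  ... | no _ | no _ = count-∪ N

  count-collapse : ∀ e N → e ≤ N → (∀ {c} → c < e → P c → Q c) → (∀ {c} → e < c → P c → Q (pred c)) →
    count P? (suc N) ≤ suc (count Q? N)
  count-collapse e N e≤N below above with m≤n⇒m<n∨m≡n e≤N
  ... | inj₂ refl = ≤-trans (count-suc≤suc P? e) (s≤s (count-mono e below))
  count-collapse e (suc N) _ below above | inj₁ e<1+N with P? (suc N)
  ... | yes pN = begin
      suc (count P? (suc N))   ≤⟨ s≤s (count-collapse e N (≤-pred e<1+N) below above) ⟩
      suc (suc (count Q? N))   ≡⟨ cong suc (count-yes Q? (above e<1+N pN)) ⟨
      suc (count Q? (suc N))   ∎
    where open ≤-Reasoning
  ... | no _ = ≤-trans (count-collapse e N (≤-pred e<1+N) below above) (s≤s (count-suc≤ Q? N))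

count-interval : ∀ lo hi N → count ((lo <?_) ∩? (_<? hi)) N ≤ hi ∸ suc lo
count-interval lo hi N = ≤-trans (bounded N) (∸-monoˡ-≤ (suc lo) (m⊓n≤n N hi))
  where
  bounded : ∀ N → count ((lo <?_) ∩? (_<? hi)) N ≤ N ⊓ hi ∸ suc lo
  widen : ∀ N → count ((lo <?_) ∩? (_<? hi)) N ≤ suc N ⊓ hi ∸ suc lo
  bounded zero = z≤n
  bounded (suc N) with lo <? N | N <? hi
  ... | yes lo<N | yes N<hi = begin
      suc (count ((lo <?_) ∩? (_<? hi)) N) ≤⟨ s≤s (bounded N) ⟩
      suc (N ⊓ hi ∸ suc lo)               ≡⟨ +-∸-assoc 1 (subst (lo <_) (sym N⊓hi≡N) lo<N) ⟨
      suc (N ⊓ hi) ∸ suc lo               ≡⟨ cong (λ m → suc m ∸ suc lo) N⊓hi≡N ⟩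
      suc N ∸ suc lo                      ≡⟨ cong (_∸ suc lo) (m≤n⇒m⊓n≡m N<hi) ⟨
      suc N ⊓ hi ∸ suc lo                 ∎
    where open ≤-Reasoning
          N⊓hi≡N = m≤n⇒m⊓n≡m (<⇒≤ N<hi)
  ... | yes _ | no _ = widen N
  ... | no _ | _ = widen N

  widen N = ≤-trans (bounded N) (∸-monoˡ-≤ (suc lo) (⊓-monoˡ-≤ hi (n≤1+n N)))

-- Splitting cuts and duplication-loss steps

Splits : List ℕ → Pred ℕ 0ℓ
Splits σ c = All (_< c) (take c σ) × All (c ≤_) (drop c σ)

splits? : ∀ σ → Decidable (Splits σ)
splits? σ c = All.all? (_<? c) (take c σ) ×-dec All.all? (c ≤?_) (drop c σ)

nonSplits : List ℕ → ℕ
nonSplits σ = count (∁? (splits? σ)) (suc (length σ))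

module _ {xs ys : List ℕ} (xs↭ys : xs ↭ ys) where

  splits-↭-prefix : ∀ {c} zs → length ys ≤ c → Splits (ys ++ zs) c → Splits (xs ++ zs) c
  splits-↭-prefix {c} zs ys≤c (lo , hi) = lo′ , hi′
    where
    xs≤c : length xs ≤ c
    xs≤c = subst (_≤ c) (sym (↭-length xs↭ys)) ys≤c
    lo′ : All (_< c) (take c (xs ++ zs))
    lo′ rewrite take-++-≥ xs zs xs≤c | ↭-length xs↭ys =
      All-resp-↭ (↭-sym (++⁺ʳ _ xs↭ys)) (subst (All (_< c)) (take-++-≥ ys zs ys≤c) lo)
    hi′ : All (c ≤_) (drop c (xs ++ zs))
    hi′ rewrite drop-++-≥ xs zs xs≤c | ↭-length xs↭ys = subst (All (c ≤_)) (drop-++-≥ ys zs ys≤c) hi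

  splits-↭-suffix : ∀ {c} zs → c ≤ length zs → Splits (zs ++ ys) c → Splits (zs ++ xs) c
  splits-↭-suffix {c} zs c≤zs (lo , hi) rewrite take-++-≤ zs ys c≤zs | drop-++-≤ zs ys c≤zs =
    subst (All (_< c)) (sym (take-++-≤ zs xs c≤zs)) lo ,
    subst (All (c ≤_)) (sym (drop-++-≤ zs xs c≤zs)) (All-resp-↭ (++⁺ˡ (drop c zs) (↭-sym xs↭ys)) hi)

splits-↭-infix : ∀ {S f} a b {c} → S ↭ f → Splits (a ++ f ++ b) c →
  ¬ (length a < c × c < length a + length f) → Splits (a ++ S ++ b) c
splits-↭-infix {S} {f} a b {c} S↭f sp outside with length a <? c
... | no c≮a = splits-↭-suffix (++⁺ʳ b S↭f) a (≮⇒≥ c≮a) sp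
... | yes a<c = subst (λ σ → Splits σ c) (++-assoc a S b)
      (splits-↭-prefix (++⁺ˡ a S↭f) b (subst (_≤ c) (sym (length-++ a)) (≮⇒≥ λ c< → outside (a<c , c<)))
        (subst (λ σ → Splits σ c) (sym (++-assoc a f b)) sp))

nonSplits-↭-infix : ∀ {S f} a b → S ↭ f → nonSplits (a ++ S ++ b) ≤ nonSplits (a ++ f ++ b) + (length f ∸ 1)
nonSplits-↭-infix {S} {f} a b S↭f = begin
  count (∁? (splits? new)) (suc (length new))
    ≡⟨ cong (count (∁? (splits? new)) ∘ suc) (↭-length (++⁺ˡ a (++⁺ʳ b S↭f))) ⟩
  count (∁? (splits? new)) M
    ≤⟨ count-mono (∁? (splits? new)) (∁? (splits? old) ∪? inside?) M (λ _ → source) ⟩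
  count (∁? (splits? old) ∪? inside?) M
    ≤⟨ count-∪ (∁? (splits? old)) inside? M ⟩
  nonSplits old + count inside? M
    ≤⟨ +-monoʳ-≤ (nonSplits old) (count-interval (length a) (length a + length f) M) ⟩
  nonSplits old + (length a + length f ∸ suc (length a))
    ≡⟨ cong (λ n → nonSplits old + (length a + length f ∸ n)) (+-comm 1 (length a)) ⟩
  nonSplits old + (length a + length f ∸ (length a + 1))
    ≡⟨ cong (nonSplits old +_) ([m+n]∸[m+o]≡n∸o (length a) (length f) 1) ⟩
  nonSplits old + (length f ∸ 1) ∎
  where
  open ≤-Reasoning
  new = a ++ S ++ b
  old = a ++ f ++ b
  M = suc (length old)
  inside? = (length a <?_) ∩? (_<? length a + length f)
  source : ∀ {c} → ¬ Splits new c → ¬ Splits old c ⊎ (length a < c × c < length a + length f)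
  source {c} ¬sp with splits? old c | inside? c
  ... | no ¬sp′ | _ = inj₁ ¬sp′
  ... | yes _ | yes inside = inj₂ inside
  ... | yes sp | no outside = ⊥-elim (¬sp (splits-↭-infix a b S↭f sp outside))

select++reject↭ : (m : List Bool) (f : List ℕ) → length m ≡ length f → select m f ++ reject m f ↭ f
select++reject↭ [] [] _ = ↭-refl
select++reject↭ (true ∷ m) (x ∷ f) eq = ↭-prep x (select++reject↭ m f (suc-injective eq))
select++reject↭ (false ∷ m) (x ∷ f) eq =
  ↭-trans (shift x (select m f) (reject m f)) (↭-prep x (select++reject↭ m f (suc-injective eq)))

nonSplits-step : ∀ {K π π′} → DLStep K π π′ → nonSplits π′ ≤ nonSplits π + (K ∸ 1)
nonSplits-step (a , f , b , m , f≤K , m≡f , refl , refl)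
  rewrite sym (++-assoc (select m f) (reject m f) b) =
  ≤-trans (nonSplits-↭-infix a b (select++reject↭ m f m≡f)) (+-monoʳ-≤ _ (∸-monoˡ-≤ 1 f≤K))

nonSplits-steps : ∀ {K p π π′} → Steps K p π π′ → nonSplits π′ ≤ nonSplits π + p * (K ∸ 1)
nonSplits-steps {π = π} done = m≤m+n (nonSplits π) 0
nonSplits-steps {K} {suc p} {π} (step {π' = π′} {π'' = π″} s ss) = begin
  nonSplits π″                         ≤⟨ nonSplits-steps ss ⟩
  nonSplits π′ + p * (K ∸ 1)           ≤⟨ +-monoˡ-≤ (p * (K ∸ 1)) (nonSplits-step s) ⟩
  nonSplits π + (K ∸ 1) + p * (K ∸ 1)  ≡⟨ +-assoc (nonSplits π) (K ∸ 1) _ ⟩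
  nonSplits π + suc p * (K ∸ 1)        ∎
  where open ≤-Reasoning

range : ℕ → ℕ → List ℕ
range o zero = []
range o (suc k) = o ∷ range (suc o) k

applyUpTo≡range : ∀ {f : ℕ → ℕ} o k → (∀ x → f x ≡ o + x) → applyUpTo f k ≡ range o k
applyUpTo≡range o zero _ = refl
applyUpTo≡range o (suc k) f≡ =
  cong₂ _∷_ (trans (f≡ 0) (+-identityʳ o)) (applyUpTo≡range (suc o) k λ x → trans (f≡ (suc x)) (+-suc o x))

upTo≡range : ∀ n → upTo n ≡ range 0 n
upTo≡range n = applyUpTo≡range 0 n λ _ → refl

range-≥ : ∀ o k → All (o ≤_) (range o k)
range-≥ o zero = []
range-≥ o (suc k) = ≤-refl ∷ All.map (≤-trans (n≤1+n o)) (range-≥ (suc o) k)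

length-range : ∀ o k → length (range o k) ≡ k
length-range o zero = refl
length-range o (suc k) = cong suc (length-range (suc o) k)

range-++ : ∀ o a b → range o (a + b) ≡ range o a ++ range (o + a) b
range-++ o zero b = cong (λ o′ → range o′ b) (sym (+-identityʳ o))
range-++ o (suc a) b = cong (o ∷_) (trans (range-++ (suc o) a b) (cong (λ o′ → range (suc o) a ++ range o′ b) (sym (+-suc o a))))

length-range-++ : ∀ b xs → length (range 0 b ++ xs) ≡ b + length xs
length-range-++ b xs = trans (length-++ (range 0 b)) (cong (_+ length xs) (length-range 0 b))

range-splits : ∀ o k c → All (_< o + c) (take c (range o k)) × All (o + c ≤_) (drop c (range o k))
range-splits o zero zero = [] , []
range-splits o zero (suc c) = [] , []
range-splits o (suc k) zero = [] , subst (λ n → All (n ≤_) (range o (suc k))) (sym (+-identityʳ o)) (range-≥ o (suc k))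
range-splits o (suc k) (suc c) with range-splits (suc o) k c
... | lo , hi = subst (o <_) o+1+c≡ (s≤s (m≤m+n o c)) ∷ All.map (λ {x} → subst (x <_) o+1+c≡) lo ,
                All.map (λ {x} → subst (_≤ x) o+1+c≡) hi
  where o+1+c≡ : suc o + c ≡ o + suc c
        o+1+c≡ = sym (+-suc o c)

upTo-splits : ∀ n c → Splits (upTo n) c
upTo-splits n c rewrite upTo≡range n = range-splits 0 n c

nonSplits-upTo : ∀ n → nonSplits (upTo n) ≡ 0
nonSplits-upTo n = count-≡0 (∁? (splits? (upTo n))) (suc (length (upTo n))) λ {c} _ ¬sp → ¬sp (upTo-splits n c)

nonSplits-InC : ∀ K p τ → InC K p τ → nonSplits τ ≤ p * (K ∸ 1)
nonSplits-InC K p τ τ∈C = subst (λ n → nonSplits τ ≤ n + p * (K ∸ 1)) (nonSplits-upTo (length τ)) (nonSplits-steps τ∈C)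

-- The vp-domain

¬splits-left-of : ∀ A x B {c} → length A < c → c ≤ x → ¬ Splits (A ++ x ∷ B) c
¬splits-left-of A x B A<c c≤x (below , _) = <⇒≱ (All-take-∷ A A<c below) c≤x

¬splits-right-of : ∀ A x B {c} → x < c → c ≤ length A → ¬ Splits (A ++ x ∷ B) c
¬splits-right-of A x B x<c c≤A (_ , above) = <⇒≱ x<c (All-drop-∷ A c≤A above)

¬splits-crossing : ∀ A x B {c} → length A ⊓ x < c → c ≤ length A ⊔ x → ¬ Splits (A ++ x ∷ B) c
¬splits-crossing A x B {c} lo<c c≤hi with ≤-total (length A) x
... | inj₁ A≤x = ¬splits-left-of A x B (subst (_< c) (m≤n⇒m⊓n≡m A≤x) lo<c) (subst (c ≤_) (m≤n⇒m⊔n≡n A≤x) c≤hi)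
... | inj₂ x≤A = ¬splits-right-of A x B (subst (_< c) (m≥n⇒m⊓n≡n x≤A) lo<c) (subst (c ≤_) (m≥n⇒m⊔n≡m x≤A) c≤hi)

split-at-lookup : ∀ (xs : List ℕ) j → ∃ λ A → ∃ λ B → xs ≡ A ++ lookup xs j ∷ B × length A ≡ toℕ j
split-at-lookup (x ∷ xs) zero = [] , xs , refl , refl
split-at-lookup (x ∷ xs) (suc j) with split-at-lookup xs j
... | A , B , xs≡ , A≡j = x ∷ A , B , cong (x ∷_) xs≡ , cong suc A≡j

⊓<⊔ : ∀ {m n} → m ≢ n → m ⊓ n < m ⊔ n
⊓<⊔ {m} {n} m≢n with <-cmp m n
... | tri< m<n _ _ = subst₂ _<_ (sym (m≤n⇒m⊓n≡m (<⇒≤ m<n))) (sym (m≤n⇒m⊔n≡n (<⇒≤ m<n))) m<n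
... | tri≈ _ m≡n _ = ⊥-elim (m≢n m≡n)
... | tri> _ _ n<m = subst₂ _<_ (sym (m≥n⇒m⊓n≡n (<⇒≤ n<m))) (sym (m≥n⇒m⊔n≡m (<⇒≤ n<m))) n<m

cut-at-or-after : ∀ {lo hi q} → lo < hi → lo ≤ q → q ≤ hi → (lo < q × q ≤ hi) ⊎ (lo < suc q × suc q ≤ hi)
cut-at-or-after {lo} {hi} {q} lo<hi lo≤q q≤hi with q <? hi
... | yes q<hi = inj₂ (s≤s lo≤q , q<hi)
... | no q≮hi = inj₁ (subst (lo <_) (≤-antisym (≮⇒≥ q≮hi) q≤hi) lo<hi , q≤hi)

NextToNonSplit : List ℕ → Pred ℕ 0ℓ
NextToNonSplit σ q = ¬ Splits σ q ⊎ ¬ Splits σ (suc q)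

nextToNonSplit? : ∀ σ → Decidable (NextToNonSplit σ)
nextToNonSplit? σ = ∁? (splits? σ) ∪? (λ q → ∁? (splits? σ) (suc q))

InVPVector⇒nextToNonSplit : ∀ σ i v → InVPVector σ i v → ∃ λ q → lookup σ q ≡ v × NextToNonSplit σ (toℕ q)
InVPVector⇒nextToNonSplit σ i v (σi≢i , j , q , σj≡i , refl , lo≤q , q≤hi) =
  q , refl , Sum.map (uncurry crossed) (uncurry crossed) (cut-at-or-after lo<hi lo≤q q≤hi)
  where
  j≢i : toℕ j ≢ toℕ i
  j≢i j≡i = σi≢i (subst (λ k → lookup σ k ≡ toℕ i) (toℕ-injective j≡i) σj≡i)
  lo<hi = ⊓<⊔ j≢i
  crossed : ∀ {c} → toℕ j ⊓ toℕ i < c → c ≤ toℕ j ⊔ toℕ i → ¬ Splits σ c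
  crossed {c} lo<c c≤hi with split-at-lookup σ j
  ... | A , B , σ≡ , A≡j = subst (λ xs → ¬ Splits xs c) (sym σ≡) (¬splits-crossing A (lookup σ j) B
          (subst (_< c) (sym (cong₂ _⊓_ A≡j σj≡i)) lo<c) (subst (c ≤_) (sym (cong₂ _⊔_ A≡j σj≡i)) c≤hi))

vpDomain-positions : ∀ σ vs → All (InVPDomain σ) vs →
  Σ (List (Fin (length σ))) λ ps → map (lookup σ) ps ≡ vs × All (NextToNonSplit σ ∘ toℕ) ps
vpDomain-positions σ [] [] = [] , refl , []
vpDomain-positions σ (v ∷ vs) ((i , inVector) ∷ inDomain)
  with InVPVector⇒nextToNonSplit σ i v inVector | vpDomain-positions σ vs inDomain
... | q , refl , near | ps , refl , nears = q ∷ ps , refl , near ∷ nears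

vpDomain-bound : ∀ σ vs → Unique vs → All (InVPDomain σ) vs → length vs ≤ 2 * nonSplits σ
vpDomain-bound σ vs u inDomain with vpDomain-positions σ vs inDomain
... | ps , refl , nearNonSplit = begin
  length (map (lookup σ) ps)                                ≡⟨ trans (length-map (lookup σ) ps) (sym (length-map toℕ ps)) ⟩
  length (map toℕ ps)                                       ≤⟨ pigeonhole (nextToNonSplit? σ) n (map toℕ ps) distinct below ⟩
  count (nextToNonSplit? σ) n                               ≤⟨ count-∪ (∁? (splits? σ)) (λ q → ∁? (splits? σ) (suc q)) n ⟩
  count (∁? (splits? σ)) n + count (λ q → ∁? (splits? σ) (suc q)) n
                                                            ≤⟨ +-mono-≤ (count-suc≤ (∁? (splits? σ)) n) (count-shift≤ (∁? (splits? σ)) n) ⟩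
  nonSplits σ + nonSplits σ                                 ≡⟨ cong (nonSplits σ +_) (+-identityʳ (nonSplits σ)) ⟨
  2 * nonSplits σ                                           ∎
  where
  open ≤-Reasoning
  n = length σ
  distinct : Unique (map toℕ ps)
  distinct = Unique.map⁺ toℕ-injective (Unique.map⁻ u)
  below : All (λ q → q < n × NextToNonSplit σ q) (map toℕ ps)
  below = All.map⁺ (All.map (λ {q} near → toℕ<n q , near) nearNonSplit)

-- Deleting one entry

nonSplits-collapse : ∀ σ τ e → length σ ≡ suc (length τ) → e ≤ length σ →
  (∀ {c} → c < e → Splits τ c → Splits σ c) → (∀ {c} → e ≤ c → Splits τ c → Splits σ (suc c)) →
  nonSplits σ ≤ suc (nonSplits τ)
nonSplits-collapse σ τ e σ≡ e≤σ below above =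
  subst (λ n → nonSplits σ ≤ suc (count (∁? (splits? τ)) n)) σ≡
    (count-collapse (∁? (splits? σ)) (∁? (splits? τ)) e (length σ) e≤σ (λ c<e ¬sp sp → ¬sp (below c<e sp)) above′)
  where
  above′ : ∀ {c} → e < c → ¬ Splits σ c → ¬ Splits τ (pred c)
  above′ {suc c} (s≤s e≤c) ¬sp sp = ¬sp (above e≤c sp)

-- Standardisation of the remaining values once the value v is deleted.
squash : ℕ → ℕ → ℕ
squash v a with a <? v
... | yes _ = a
... | no _ = pred a

squash-< : ∀ v {a} → a < v → squash v a ≡ a
squash-< v {a} a<v with a <? v
... | yes _ = refl
... | no a≮v = ⊥-elim (a≮v a<v)

squash-≥ : ∀ v {a} → v ≤ a → squash v a ≡ pred a
squash-≥ v {a} v≤a with a <? v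
... | yes a<v = ⊥-elim (<⇒≱ a<v v≤a)
... | no _ = refl

squash-≤ : ∀ v a → squash v a ≤ a
squash-≤ v a with a <? v
... | yes _ = ≤-refl
... | no _ = pred[n]≤n

squash<⇒≤ : ∀ v a {c} → squash v a < c → a ≤ c
squash<⇒≤ v a sq<c with a <? v
... | yes _ = <⇒≤ sq<c
squash<⇒≤ v zero sq<c | no _ = z≤n
squash<⇒≤ v (suc a) sq<c | no _ = sq<c

squash<⇒< : ∀ v {a c} → a ≢ v → c ≤ v → squash v a < c → a < c
squash<⇒< v {a} a≢v c≤v sq<c with a <? v
... | yes _ = sq<c
... | no a≮v = ⊥-elim (<⇒≱ sq<c (≤-trans c≤v (<⇒≤pred (≤∧≢⇒< (≮⇒≥ a≮v) (a≢v ∘ sym)))))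

≤squash⇒< : ∀ v a {c} → a ≢ v → v ≤ c → c ≤ squash v a → c < a
≤squash⇒< v a a≢v v≤c c≤sq with a <? v
... | yes a<v = ⊥-elim (<⇒≱ a<v (≤-trans v≤c c≤sq))
≤squash⇒< v zero a≢v v≤c c≤sq | no 0≮v = ⊥-elim (a≢v (sym (n≤0⇒n≡0 (≮⇒≥ 0≮v))))
≤squash⇒< v (suc a) a≢v v≤c c≤sq | no _ = s≤s c≤sq

squash-mono-≤ : ∀ v {a b} → a ≤ b → squash v a ≤ squash v b
squash-mono-≤ v {a} {b} a≤b with a <? v | b <? v
... | yes _ | yes _ = a≤b
... | yes a<v | no b≮v = <⇒≤pred (<-≤-trans a<v (≮⇒≥ b≮v))
... | no a≮v | yes b<v = ⊥-elim (a≮v (≤-<-trans a≤b b<v))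
... | no _ | no _ = pred-mono-≤ a≤b

squash-mono-< : ∀ v {a b} → a ≢ v → b ≢ v → a < b → squash v a < squash v b
squash-mono-< v {a} {b} a≢v b≢v a<b with a <? v | b <? v
... | yes _ | yes _ = a<b
... | yes a<v | no b≮v = <-≤-trans a<v (<⇒≤pred (≤∧≢⇒< (≮⇒≥ b≮v) (b≢v ∘ sym)))
... | no a≮v | yes b<v = ⊥-elim (a≮v (<-trans a<b b<v))
... | no a≮v | no _ = pred-mono-< {{>-nonZero (≤-<-trans z≤n (≤∧≢⇒< (≮⇒≥ a≮v) (a≢v ∘ sym)))}} a<b

map-squash-range-below : ∀ v o k → o + k ≤ v → map (squash v) (range o k) ≡ range o k
map-squash-range-below v o zero _ = refl
map-squash-range-below v o (suc k) o+1+k≤v =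
  cong₂ _∷_ (squash-< v (≤-trans (s≤s (m≤m+n o k)) 1+o+k≤v)) (map-squash-range-below v (suc o) k 1+o+k≤v)
  where 1+o+k≤v = subst (_≤ v) (+-suc o k) o+1+k≤v

map-squash-range-above : ∀ v o k → v ≤ o → map (squash v) (range (suc o) k) ≡ range o k
map-squash-range-above v o zero _ = refl
map-squash-range-above v o (suc k) v≤o =
  cong₂ _∷_ (squash-≥ v (m≤n⇒m≤1+n v≤o)) (map-squash-range-above v (suc o) k (m≤n⇒m≤1+n v≤o))

lookup-map-cast : ∀ (f : ℕ → ℕ) xs .(eq : length xs ≡ length (map f xs)) i → lookup (map f xs) (cast eq i) ≡ f (lookup xs i)
lookup-map-cast f (x ∷ xs) eq zero = refl
lookup-map-cast f (x ∷ xs) eq (suc i) = lookup-map-cast f xs (suc-injective eq) i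

map-OrderIso : ∀ (f : ℕ → ℕ) xs → (∀ {a b} → a ≤ b → f a ≤ f b) →
  (∀ {a b} → a ∈ xs → b ∈ xs → a < b → f a < f b) → OrderIso xs (map f xs)
map-OrderIso f xs mono strict = eq , λ i j → mk⇔ (to i j) (from i j)
  where
  eq = sym (length-map f xs)
  to : ∀ i j → lookup xs i < lookup xs j → lookup (map f xs) (cast eq i) < lookup (map f xs) (cast eq j)
  to i j lt rewrite lookup-map-cast f xs eq i | lookup-map-cast f xs eq j = strict (∈-lookup i) (∈-lookup j) lt
  from : ∀ i j → lookup (map f xs) (cast eq i) < lookup (map f xs) (cast eq j) → lookup xs i < lookup xs j
  from i j lt rewrite lookup-map-cast f xs eq i | lookup-map-cast f xs eq j = ≰⇒> λ ge → <⇒≱ lt (mono ge)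

CloseStrictPattern : List ℕ → Set
CloseStrictPattern σ = Σ (List ℕ) λ τ → IsPattern τ σ × length τ < length σ × nonSplits σ ≤ suc (nonSplits τ)

module Deletion (L : List ℕ) (v : ℕ) (R : List ℕ) (σ-perm : IsPerm (L ++ v ∷ R)) where

  σ τ : List ℕ
  σ = L ++ v ∷ R
  τ = map (squash v) (L ++ R)

  v∉L++R : All (v ≢_) (L ++ R)
  v∉L++R = proj₁ (Unique-remove L v R (Unique-resp-↭ (↭-sym σ-perm) (Unique.upTo⁺ (length σ))))

  length-σ : length σ ≡ suc (length τ)
  length-σ = trans (length-++-∷ L R) (cong suc (sym (length-map (squash v) (L ++ R))))

  τ-perm : IsPerm τ
  τ-perm = subst (τ ↭_) τ-values (map⁺ (squash v) (drop-mid L (range 0 v) (subst (σ ↭_) σ-values σ-perm)))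
    where
    t = length τ
    v≤t : v ≤ t
    v≤t = ≤-pred (subst (v <_) length-σ (∈-upTo⁻ (∈-resp-↭ σ-perm (∈-insert L))))
    m = t ∸ v
    v+m≡t : v + m ≡ t
    v+m≡t = m+[n∸m]≡n v≤t
    σ-values : upTo (length σ) ≡ range 0 v ++ v ∷ range (suc v) m
    σ-values = begin
      upTo (length σ)     ≡⟨ cong upTo length-σ ⟩
      upTo (suc t)        ≡⟨ upTo≡range (suc t) ⟩
      range 0 (suc t)     ≡⟨ cong (range 0) (trans (+-suc v m) (cong suc v+m≡t)) ⟨
      range 0 (v + suc m) ≡⟨ range-++ 0 v (suc m) ⟩
      range 0 v ++ v ∷ range (suc v) m ∎
      where open ≡-Reasoning
    τ-values : map (squash v) (range 0 v ++ range (suc v) m) ≡ upTo t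
    τ-values = begin
      map (squash v) (range 0 v ++ range (suc v) m)               ≡⟨ map-++ (squash v) (range 0 v) _ ⟩
      map (squash v) (range 0 v) ++ map (squash v) (range (suc v) m)
        ≡⟨ cong₂ _++_ (map-squash-range-below v 0 v ≤-refl) (map-squash-range-above v v m ≤-refl) ⟩
      range 0 v ++ range v m                                     ≡⟨ range-++ 0 v m ⟨
      range 0 (v + m)                                            ≡⟨ cong (range 0) v+m≡t ⟩
      range 0 t                                                  ≡⟨ upTo≡range t ⟨
      upTo t                                                     ∎
      where open ≡-Reasoning

  τ-pattern : IsPattern τ σ
  τ-pattern = τ-perm , L ++ R , Sublist.++⁺ ⊆-refl (v ∷ʳ ⊆-refl) ,
    map-OrderIso (squash v) (L ++ R) (squash-mono-≤ v) (λ a∈ b∈ → squash-mono-< v (≢v a∈) (≢v b∈))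
    where
    ≢v : ∀ {a} → a ∈ L ++ R → a ≢ v
    ≢v a∈ = All.lookup v∉L++R a∈ ∘ sym

  splits-below : ∀ {c} → c ≤ length L → c ≤ v → Splits τ c → Splits σ c
  splits-below {c} c≤L c≤v (lo , hi) = lo′ , hi′
    where
    lo′ : All (_< c) (take c σ)
    lo′ = subst (All (_< c)) (sym (take-++-≤ L (v ∷ R) c≤L))
      (All.zipWith (λ (v≢a , sq<c) → squash<⇒< v (v≢a ∘ sym) c≤v sq<c)
        (All.take⁺ c (All.++⁻ˡ L v∉L++R) ,
         All.map⁻ (subst (All (_< c)) (trans (take-map c (L ++ R)) (cong (map (squash v)) (take-++-≤ L R c≤L))) lo)))
    hi′ : All (c ≤_) (drop c σ)
    hi′ = subst (All (c ≤_)) (sym (drop-++-≤ L (v ∷ R) c≤L))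
      (All-++-∷ (drop c L) (All.map (λ {a} c≤sq → ≤-trans c≤sq (squash-≤ v a))
        (All.map⁻ (subst (All (c ≤_)) (trans (drop-map c (L ++ R)) (cong (map (squash v)) (drop-++-≤ L R c≤L))) hi)))
        c≤v)

  splits-above : ∀ {c} → length L ≤ c → v ≤ c → Splits τ c → Splits σ (suc c)
  splits-above {c} L≤c v≤c (lo , hi) = lo′ , hi′
    where
    L≤1+c = m≤n⇒m≤1+n L≤c
    1+c∸L : suc c ∸ length L ≡ suc (c ∸ length L)
    1+c∸L = +-∸-assoc 1 L≤c
    lo′ : All (_< suc c) (take (suc c) σ)
    lo′ = subst (All (_< suc c)) (sym (trans (take-++-≥ L (v ∷ R) L≤1+c) (cong (λ n → L ++ take n (v ∷ R)) 1+c∸L)))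
      (All-++-∷ L (All.map (λ {a} sq<c → s≤s (squash<⇒≤ v a sq<c))
         (All.map⁻ (subst (All (_< c)) (trans (take-map c (L ++ R)) (cong (map (squash v)) (take-++-≥ L R L≤c))) lo)))
        (s≤s v≤c))
    hi′ : All (suc c ≤_) (drop (suc c) σ)
    hi′ = subst (All (suc c ≤_)) (sym (trans (drop-++-≥ L (v ∷ R) L≤1+c) (cong (λ n → drop n (v ∷ R)) 1+c∸L)))
      (All.zipWith (λ {a} (v≢a , c≤sq) → ≤squash⇒< v a (v≢a ∘ sym) v≤c c≤sq)
        (All.drop⁺ (c ∸ length L) (All.++⁻ʳ L v∉L++R) ,
         All.map⁻ (subst (All (c ≤_)) (trans (drop-map c (L ++ R)) (cong (map (squash v)) (drop-++-≥ L R L≤c))) hi)))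

  closeStrictPattern : ∀ e → e ≤ length σ →
    (∀ {c} → c < e → Splits τ c → Splits σ c) → (∀ {c} → e ≤ c → Splits τ c → Splits σ (suc c)) →
    CloseStrictPattern σ
  closeStrictPattern e e≤σ below above =
    τ , τ-pattern , subst (length τ <_) (sym length-σ) ≤-refl , nonSplits-collapse σ τ e length-σ e≤σ below above

-- The first mismatch with the identity

∈-range⁻ : ∀ {x} b → x ∈ range 0 b → x < b
∈-range⁻ {x} b x∈ = ∈-upTo⁻ (subst (x ∈_) (sym (upTo≡range b)) x∈)

∈-range⁺ : ∀ {x} b → x < b → x ∈ range 0 b
∈-range⁺ {x} b x<b = subst (x ∈_) (upTo≡range b) (∈-upTo⁺ x<b)

range-or-mismatch : ∀ o xs → xs ≡ range o (length xs) ⊎ ∃ λ k → ∃ λ w → ∃ λ R → xs ≡ range o k ++ w ∷ R × w ≢ o + k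
range-or-mismatch o [] = inj₁ refl
range-or-mismatch o (x ∷ xs) with x ≟ o
... | no x≢o = inj₂ (0 , x , xs , refl , λ x≡ → x≢o (trans x≡ (+-identityʳ o)))
... | yes refl with range-or-mismatch (suc o) xs
...   | inj₁ xs≡ = inj₁ (cong (o ∷_) xs≡)
...   | inj₂ (k , w , R , xs≡ , w≢) = inj₂ (suc k , w , R , cong (o ∷_) xs≡ , λ w≡ → w≢ (trans w≡ (+-suc o k)))

module _ (b v₁ : ℕ) (R₂ R₃ : List ℕ) where

  private
    r = b + suc (length R₂)

    length-prefix : length (range 0 b ++ v₁ ∷ R₂) ≡ r
    length-prefix = length-range-++ b (v₁ ∷ R₂)

  delete-mismatched-entry : IsPerm (range 0 b ++ v₁ ∷ R₂ ++ b ∷ R₃) → b < v₁ → v₁ ≤ r →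
    CloseStrictPattern (range 0 b ++ v₁ ∷ R₂ ++ b ∷ R₃)
  delete-mismatched-entry perm b<v₁ v₁≤r = closeStrictPattern (suc b) 1+b≤σ below above
    where
    open Deletion (range 0 b) v₁ (R₂ ++ b ∷ R₃) perm
    b≡L = sym (length-range 0 b)
    1+b≤σ : suc b ≤ length σ
    1+b≤σ = subst (suc b ≤_) (sym (length-range-++ b (v₁ ∷ R₂ ++ b ∷ R₃))) (m<m+n b z<s)
    below : ∀ {c} → c < suc b → Splits τ c → Splits σ c
    below c<1+b = splits-below (subst (_ ≤_) b≡L (≤-pred c<1+b)) (≤-trans (≤-pred c<1+b) (<⇒≤ b<v₁))
    above : ∀ {c} → suc b ≤ c → Splits τ c → Splits σ (suc c)
    above {c} b<c sp with v₁ ≤? c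
    ... | yes v₁≤c = splits-above (subst (_≤ c) b≡L (<⇒≤ b<c)) v₁≤c sp
    ... | no v₁≰c = ⊥-elim (¬splits-right-of A b B b<c c≤A (subst (λ xs → Splits xs c) τ≡ sp))
      where
      A = map (squash v₁) (range 0 b ++ R₂)
      B = map (squash v₁) R₃
      τ≡ : τ ≡ A ++ b ∷ B
      τ≡ = begin
        map (squash v₁) (range 0 b ++ R₂ ++ b ∷ R₃)   ≡⟨ cong (map (squash v₁)) (++-assoc (range 0 b) R₂ (b ∷ R₃)) ⟨
        map (squash v₁) ((range 0 b ++ R₂) ++ b ∷ R₃) ≡⟨ map-++ (squash v₁) (range 0 b ++ R₂) (b ∷ R₃) ⟩
        A ++ squash v₁ b ∷ B                          ≡⟨ cong (λ x → A ++ x ∷ B) (squash-< v₁ b<v₁) ⟩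
        A ++ b ∷ B                                    ∎
        where open ≡-Reasoning
      c≤A : c ≤ length A
      c≤A = subst (c ≤_) (sym (trans (length-map (squash v₁) (range 0 b ++ R₂)) (length-range-++ b R₂)))
              (≤-pred (≤-trans (≰⇒> v₁≰c) (subst (v₁ ≤_) (+-suc b (length R₂)) v₁≤r)))

  delete-displaced-value : IsPerm ((range 0 b ++ v₁ ∷ R₂) ++ b ∷ R₃) → r < v₁ →
    CloseStrictPattern ((range 0 b ++ v₁ ∷ R₂) ++ b ∷ R₃)
  delete-displaced-value perm r<v₁ = closeStrictPattern r r≤σ below above
    where
    open Deletion (range 0 b ++ v₁ ∷ R₂) b R₃ perm
    r≡L = sym length-prefix
    b<r : b < r
    b<r = m<m+n b z<s
    r≤σ : r ≤ length σ
    r≤σ = subst (r ≤_) (sym (length-++ (range 0 b ++ v₁ ∷ R₂))) (subst (λ n → r ≤ n + length (b ∷ R₃)) r≡L (m≤m+n r _))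
    below : ∀ {c} → c < r → Splits τ c → Splits σ c
    below {c} c<r sp with c ≤? b
    ... | yes c≤b = splits-below (subst (c ≤_) r≡L (<⇒≤ c<r)) c≤b sp
    ... | no c≰b = ⊥-elim (¬splits-left-of A (squash b v₁) B A<c c≤v₁′ (subst (λ xs → Splits xs c) τ≡ sp))
      where
      A = map (squash b) (range 0 b)
      B = map (squash b) (R₂ ++ R₃)
      τ≡ : τ ≡ A ++ squash b v₁ ∷ B
      τ≡ = trans (cong (map (squash b)) (++-assoc (range 0 b) (v₁ ∷ R₂) R₃)) (map-++ (squash b) (range 0 b) (v₁ ∷ R₂ ++ R₃))
      A<c : length A < c
      A<c = subst (_< c) (sym (trans (length-map (squash b) (range 0 b)) (length-range 0 b))) (≰⇒> c≰b)
      c≤v₁′ : c ≤ squash b v₁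
      c≤v₁′ = subst (c ≤_) (sym (squash-≥ b (<⇒≤ (<-trans b<r r<v₁)))) (<⇒≤pred (<-trans c<r r<v₁))
    above : ∀ {c} → r ≤ c → Splits τ c → Splits σ (suc c)
    above {c} r≤c = splits-above (subst (_≤ c) r≡L r≤c) (<⇒≤ (<-≤-trans b<r r≤c))

mismatch-< : ∀ b v₁ R₁ → IsPerm (range 0 b ++ v₁ ∷ R₁) → v₁ ≢ b → b < v₁
mismatch-< b v₁ R₁ perm v₁≢b with v₁ <? b
... | no v₁≮b = ≤∧≢⇒< (≮⇒≥ v₁≮b) (v₁≢b ∘ sym)
... | yes v₁<b = ⊥-elim (All.lookup (Deletion.v∉L++R (range 0 b) v₁ R₁ perm) (∈-++⁺ˡ (∈-range⁺ b v₁<b)) refl)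

mismatch-closeStrictPattern : ∀ b v₁ R₁ → IsPerm (range 0 b ++ v₁ ∷ R₁) → v₁ ≢ b →
  CloseStrictPattern (range 0 b ++ v₁ ∷ R₁)
mismatch-closeStrictPattern b v₁ R₁ perm v₁≢b
  with ∈-++⁻ (range 0 b) (∈-resp-↭ (↭-sym perm) (∈-upTo⁺ (subst (b <_) (sym (length-range-++ b (v₁ ∷ R₁))) (m<m+n b z<s))))
... | inj₁ b∈range = ⊥-elim (<-irrefl refl (∈-range⁻ b b∈range))
... | inj₂ (here b≡v₁) = ⊥-elim (v₁≢b (sym b≡v₁))
... | inj₂ (there b∈R₁) with ∈-∃++ b∈R₁
...   | R₂ , R₃ , refl with v₁ ≤? b + suc (length R₂)
...     | yes v₁≤r = delete-mismatched-entry b v₁ R₂ R₃ perm (mismatch-< b v₁ _ perm v₁≢b) v₁≤r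
...     | no v₁≰r = subst CloseStrictPattern (++-assoc (range 0 b) (v₁ ∷ R₂) (b ∷ R₃))
  (delete-displaced-value b v₁ R₂ R₃ (subst IsPerm (sym (++-assoc (range 0 b) (v₁ ∷ R₂) (b ∷ R₃))) perm) (≰⇒> v₁≰r))

nonIdentity-closeStrictPattern : ∀ σ → IsPerm σ → σ ≢ upTo (length σ) → CloseStrictPattern σ
nonIdentity-closeStrictPattern σ perm σ≢id with range-or-mismatch 0 σ
... | inj₁ σ≡ = ⊥-elim (σ≢id (trans σ≡ (sym (upTo≡range (length σ)))))
... | inj₂ (b , v₁ , R₁ , refl , v₁≢b) = mismatch-closeStrictPattern b v₁ R₁ perm v₁≢b

Steps-refl : ∀ K p π → Steps K p π π
Steps-refl K zero π = done
Steps-refl K (suc p) π = step (π , [] , [] , [] , z≤n , refl , sym (++-identityʳ π) , sym (++-identityʳ π)) (Steps-refl K p π)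

InC-identity : ∀ K p σ → σ ≡ upTo (length σ) → InC K p σ
InC-identity K p σ σ≡ = subst (Steps K p (upTo (length σ))) (sym σ≡) (Steps-refl K p _)

lemma3 : (K p : ℕ) → 2 ≤ K → 1 ≤ p → (σ : List ℕ) → IsPerm σ →
    ¬ InC K p σ →
    ((τ : List ℕ) → IsPattern τ σ → length τ < length σ → InC K p τ) →
    (vs : List ℕ) → Unique vs → All (InVPDomain σ) vs →
    length vs ≤ 2 * K * p + 2
lemma3 K p _ _ σ perm σ∉C minimal vs distinct inDomain
  with nonIdentity-closeStrictPattern σ perm (σ∉C ∘ InC-identity K p σ)
... | τ , τ-pattern , τ<σ , σ≤1+τ = begin
  length vs                   ≤⟨ vpDomain-bound σ vs distinct inDomain ⟩
  2 * nonSplits σ             ≤⟨ *-monoʳ-≤ 2 σ≤1+τ ⟩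
  2 * suc (nonSplits τ)       ≡⟨ *-suc 2 (nonSplits τ) ⟩
  2 + 2 * nonSplits τ         ≤⟨ +-monoʳ-≤ 2 (*-monoʳ-≤ 2 τ-bound) ⟩
  2 + 2 * (p * K)             ≡⟨ +-comm 2 _ ⟩
  2 * (p * K) + 2             ≡⟨ cong (λ n → 2 * n + 2) (*-comm p K) ⟩
  2 * (K * p) + 2             ≡⟨ cong (_+ 2) (*-assoc 2 K p) ⟨
  2 * K * p + 2               ∎
  where
  open ≤-Reasoning
  τ-bound : nonSplits τ ≤ p * K
  τ-bound = ≤-trans (nonSplits-InC K p τ (minimal τ τ-pattern τ<σ)) (*-monoʳ-≤ p (m∸n≤m K 1))
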